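{- Let ${\cal F}=(V,E)$ be a hypergraph with $V=[n]$ and all hyperedges of size at most $d$. Let $s$ be any positive integer with $s\leq d$, and let $b_1,\ldots,b_s$ be integers with $d>b_1>\cdots>b_s=1$; set $b_0=d$. Then there exists an $s$-stage group testing algorithm that finds the defective hyperedge in $E$ and uses $$O\left(\frac{d}{b_1}\log|E|+\sum_{i=2}^{s}\left(\frac{b_{i-1}}{b_i}\log|E|+b_{i-2}\right)\right)$$ tests.
   Context: Group testing on a hypergraph: $E$ is a family of subsets (hyperedges) of $[n]=\{1,\ldots,n\}$. An unknown hyperedge $e^*\in E$, the defective hyperedge, is the set of all defective elements. A test is a subset $T\subseteq[n]$ whose response is "yes" if $T\cap e^*\neq\emptyset$ and "no" otherwise. An $s$-stage algorithm performs its tests in $s$ successive stages; all tests of a stage are decided at the beginning of the stage (they may depend on responses of earlier stages, but not on responses of the same or later stages). The algorithm finds the defective hyperedge if, for every possible $e^*\in E$, it outputs $e^*$. The number of tests is the total number over all stages in the worst case; the $O(\cdot)$ hides an absolute constant. Logarithms are base 2. -}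

module Defs where

open import Data.Nat using (ℕ; zero; suc; _+_; _*_; _∸_; _/_)
open import Data.Bool using (Bool; true; false; _∧_; _∨_)
open import Data.List using (List; []; _∷_; _++_; [_]; map; length)
open import Data.Vec using (Vec; []; _∷_; zipWith; foldr′)
open import Data.Fin.Subset using (Subset)

response : ∀ {n} → Subset n → Subset n → Bool
response T e = foldr′ _∨_ false (zipWith _∧_ T e)

-- History: responses of the stages performed so far, in order
-- (one list of responses per stage).
History : Set
History = List (List Bool)

record Algorithm (n s : ℕ) : Set where
  constructor mkAlg
  field
    stages : Vec (History → List (Subset n)) s
    output : History → Subset n

runFrom : ∀ {n k} → History → Vec (History → List (Subset n)) k → Subset n → History
runFrom h [] e = h
runFrom h (f ∷ fs) e = runFrom (h ++ [ map (λ T → response T e) (f h) ]) fs e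

testsFrom : ∀ {n k} → History → Vec (History → List (Subset n)) k → Subset n → ℕ
testsFrom h [] e = 0
testsFrom h (f ∷ fs) e =
  length (f h) + testsFrom (h ++ [ map (λ T → response T e) (f h) ]) fs e

outcome : ∀ {n s} → Algorithm n s → Subset n → Subset n
outcome A e = Algorithm.output A (runFrom [] (Algorithm.stages A) e)

numTests : ∀ {n s} → Algorithm n s → Subset n → ℕ
numTests A e = testsFrom [] (Algorithm.stages A) e

-- Floor division, with the (never used here) convention m div 0 = 0.
_div_ : ℕ → ℕ → ℕ
m div zero = 0
m div suc k = m / suc k

sumTo : ℕ → (ℕ → ℕ) → ℕ
sumTo zero f = 0
sumTo (suc k) f = sumTo k f + f k

-- The bound  (d/b₁) L + Σ_{i=2}^{s} ((b_{i-1}/b_i) L + b_{i-2}),  L = log|E|,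
-- with i = j + 2 for j = 0 .. s-2.
bound : (d s L : ℕ) → (ℕ → ℕ) → ℕ
bound d s L b = (d div b 1) * L
  + sumTo (s ∸ 1) (λ j → (b (suc j) div b (suc (suc j))) * L + b j)

{-# OPTIONS --safe #-}
module Submission where

-- At the start of stage j the candidates, i.e. the hyperedges consistent with all responses so far,
-- differ from e* in at most b_j elements either way (fewer than b_j when j ≥ 1). Stage j tests
-- individually the not yet known elements of an anchor, a current candidate (none at stage 0), at a
-- cost of O(b_{j-1}) tests; afterwards the survivors agree with e* on the anchor and have at most
-- 2 b_j + 1 further elements. To push their mutual distances below b_{j+1} it suffices that for every
-- pair (A, B) of such remainders with |B ─ A| ≥ b_{j+1} some test avoids A and meets B. A random test
-- containing each element with probability 1/(8 b_j + 4) does so with probability at least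
-- b_{j+1} / (16 b_j + 8), so by double counting the best such test covers that fraction of the
-- remaining pairs, and O((b_j / b_{j+1}) log |E|) greedily chosen tests cover all of the at most |E|²
-- pairs. After the last stage the distance is below b_s = 1, so only e* survives.

open import Algebra.Properties.CommutativeSemigroup using (interchange)
open import Data.Bool using (Bool; true; false; not; _∧_; _∨_; if_then_else_)
import Data.Bool.Properties as Bool
open import Data.Fin.Subset using (Subset; inside; outside; ⊥; ∁; _∩_; _─_; ∣_∣)
open import Data.Fin.Subset.Properties using (∣p─q∣≤∣p∣; ∣⊥∣≡0; p─⊥≡p; ∩-zeroˡ)
open import Data.List
  using (List; []; _∷_; _++_; [_]; map; length; concat; replicate; filter; foldl; cartesianProduct)
import Data.List.Properties as List
open import Data.List.Properties using (≡-dec)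
open import Data.List.Extrema.Nat using (argmax; f[xs]≤f[argmax])
open import Data.List.Membership.Propositional using (_∈_; find)
open import Data.List.Membership.Propositional.Properties
  using (∈-map⁺; ∈-filter⁺; ∈-filter⁻; ∈-++⁺ˡ; ∈-++⁺ʳ; ∈-cartesianProduct⁺)
open import Data.List.Relation.Unary.All using (All; []; _∷_)
import Data.List.Relation.Unary.All as All
import Data.List.Relation.Unary.All.Properties as All
open import Data.List.Relation.Unary.Any as Any using (Any; here; there)
open import Data.List.Relation.Unary.Unique.Propositional using (Unique)
open import Data.Nat
  using (ℕ; zero; suc; pred; _+_; _*_; _∸_; _^_; _≤_; _<_; z≤n; s≤s; _≤?_; NonZero; ⌊_/2⌋; ⌈_/2⌉)
open import Data.Nat.DivMod using (_/_; _%_; m%n<n; m≡m%n+[m/n]*n; m≥n⇒m/n>0)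
open import Data.Nat.Induction using (<-rec)
open import Data.Nat.ListAction using (sum)
open import Data.Nat.ListAction.Properties using (sum-++)
open import Data.Nat.Logarithm using (⌈log₂_⌉; ⌈log₂⌈n/2⌉⌉≡⌈log₂n⌉∸1; ⌈log₂⌉-mono-≤)
open import Data.Nat.Properties
open import Data.Nat.Tactic.RingSolver using (solve-∀)
open import Data.Product using (Σ; _×_; _,_; proj₁; proj₂)
open import Data.Sum as Sum using (_⊎_; inj₁; inj₂)
open import Data.Vec using (_∷_; [])
import Data.Vec as Vec
open import Data.Vec.Properties using (∷-injectiveˡ; ∷-injectiveʳ)
open import Function using (_∘_)
open import Relation.Binary.PropositionalEquality hiding ([_])
open import Relation.Nullary using (¬_; contradiction)
open import Relation.Nullary.Decidable using (_×-dec_)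
open import Relation.Unary using (Decidable)

open import Defs

private variable
  n : ℕ
  A B : Set

-- Lists, counting and sums

count : (A → Bool) → List A → ℕ
count p xs = sum (map (λ x → if p x then 1 else 0) xs)

count-++ : (p : A → Bool) (xs ys : List A) → count p (xs ++ ys) ≡ count p xs + count p ys
count-++ p xs ys = trans (cong sum (List.map-++ _ xs ys)) (sum-++ (map _ xs) _)

count-concat-replicate : (p : A → Bool) (k : ℕ) (xs : List A) → count p (concat (replicate k xs)) ≡ k * count p xs
count-concat-replicate p zero    xs = refl
count-concat-replicate p (suc k) xs =
  trans (count-++ p xs (concat (replicate k xs))) (cong (count p xs +_) (count-concat-replicate p k xs))

count-map : (p : B → Bool) (f : A → B) (xs : List A) → count p (map f xs) ≡ count (p ∘ f) xs
count-map p f xs = cong sum (sym (List.map-∘ xs))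

count-cong : {p q : A → Bool} → (∀ x → p x ≡ q x) → (xs : List A) → count p xs ≡ count q xs
count-cong p≗q xs = cong sum (List.map-cong (λ x → cong (λ b → if b then 1 else 0) (p≗q x)) xs)

count-false : (xs : List A) → count (λ _ → false) xs ≡ 0
count-false []       = refl
count-false (x ∷ xs) = count-false xs

count-true : (xs : List A) → count (λ _ → true) xs ≡ length xs
count-true []       = refl
count-true (x ∷ xs) = cong suc (count-true xs)

count≤length : (p : A → Bool) (xs : List A) → count p xs ≤ length xs
count≤length p []       = z≤n
count≤length p (x ∷ xs) with p x
... | true  = s≤s (count≤length p xs)
... | false = m≤n⇒m≤1+n (count≤length p xs)

length-filter-false+count : (p : A → Bool) (xs : List A) → length (filter (λ x → p x Bool.≟ false) xs) + count p xs ≡ length xs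
length-filter-false+count p []       = refl
length-filter-false+count p (x ∷ xs) with p x
... | true  = trans (+-suc _ _) (cong suc (length-filter-false+count p xs))
... | false = cong suc (length-filter-false+count p xs)

sum-map-+ : (f g : A → ℕ) (xs : List A) → sum (map (λ x → f x + g x) xs) ≡ sum (map f xs) + sum (map g xs)
sum-map-+ f g []       = refl
sum-map-+ f g (x ∷ xs) = trans (cong (f x + g x +_) (sum-map-+ f g xs)) (interchange +-commutativeSemigroup (f x) (g x) _ _)

sum-map-swap : (f : A → B → ℕ) (xs : List A) (ys : List B) →
               sum (map (λ y → sum (map (λ x → f x y) xs)) ys) ≡ sum (map (λ x → sum (map (f x) ys)) xs)
sum-map-swap f []       ys = sum-zeros ys
  where
  sum-zeros : (ys : List B) → sum (map (λ _ → 0) ys) ≡ 0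
  sum-zeros []       = refl
  sum-zeros (_ ∷ ys) = sum-zeros ys
sum-map-swap f (x ∷ xs) ys = trans (sum-map-+ (f x) _ ys) (cong (sum (map (f x) ys) +_) (sum-map-swap f xs ys))

sum-map-≤ : (f : A → ℕ) {v : ℕ} (xs : List A) → All (λ x → f x ≤ v) xs → sum (map f xs) ≤ length xs * v
sum-map-≤ f []       []         = z≤n
sum-map-≤ f (x ∷ xs) (fx≤ ∷ fxs≤) = +-mono-≤ fx≤ (sum-map-≤ f xs fxs≤)

*-sum-map-≥ : (f : A → ℕ) {v : ℕ} (c : ℕ) (xs : List A) → All (λ x → v ≤ c * f x) xs →
              length xs * v ≤ c * sum (map f xs)
*-sum-map-≥ f c []       []           = z≤n
*-sum-map-≥ f c (x ∷ xs) (v≤ ∷ v≤s) =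
  ≤-trans (+-mono-≤ v≤ (*-sum-map-≥ f c xs v≤s)) (≤-reflexive (sym (*-distribˡ-+ c (f x) _)))

length-cartesianProduct : (xs : List A) (ys : List B) → length (cartesianProduct xs ys) ≡ length xs * length ys
length-cartesianProduct []       ys = refl
length-cartesianProduct (x ∷ xs) ys =
  trans (List.length-++ (map (x ,_) ys)) (cong₂ _+_ (List.length-map (x ,_) ys) (length-cartesianProduct xs ys))

map-≡⇒≡ : {f g : A → B} {xs : List A} → map f xs ≡ map g xs → ∀ {x} → x ∈ xs → f x ≡ g x
map-≡⇒≡ {xs = _ ∷ _} eq (here refl) = List.∷-injectiveˡ eq
map-≡⇒≡ {xs = _ ∷ _} eq (there x∈) = map-≡⇒≡ (List.∷-injectiveʳ eq) x∈

-- Subsets and responses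

response-⊥ : (e : Subset n) → response ⊥ e ≡ false
response-⊥ []      = refl
response-⊥ (_ ∷ e) = response-⊥ e

response-∩∁ : (T R e : Subset n) → response (T ∩ ∁ R) e ≡ response T (e ─ R)
response-∩∁ []          []            []      = refl
response-∩∁ (false ∷ T) (_       ∷ R) (_ ∷ e) = response-∩∁ T R e
response-∩∁ (true  ∷ T) (inside  ∷ R) (_ ∷ e) = response-∩∁ T R e
response-∩∁ (true  ∷ T) (outside ∷ R) (x ∷ e) = cong (x ∨_) (response-∩∁ T R e)

∣p─r∣≤∣p─q∣+∣q─r∣ : (p q r : Subset n) → ∣ p ─ r ∣ ≤ ∣ p ─ q ∣ + ∣ q ─ r ∣
∣p─r∣≤∣p─q∣+∣q─r∣ []            []            []            = z≤n
∣p─r∣≤∣p─q∣+∣q─r∣ (inside  ∷ p) (inside  ∷ q) (inside  ∷ r) = ∣p─r∣≤∣p─q∣+∣q─r∣ p q r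
∣p─r∣≤∣p─q∣+∣q─r∣ (inside  ∷ p) (inside  ∷ q) (outside ∷ r) =
  ≤-trans (s≤s (∣p─r∣≤∣p─q∣+∣q─r∣ p q r)) (≤-reflexive (sym (+-suc _ _)))
∣p─r∣≤∣p─q∣+∣q─r∣ (inside  ∷ p) (outside ∷ q) (inside  ∷ r) = m≤n⇒m≤1+n (∣p─r∣≤∣p─q∣+∣q─r∣ p q r)
∣p─r∣≤∣p─q∣+∣q─r∣ (inside  ∷ p) (outside ∷ q) (outside ∷ r) = s≤s (∣p─r∣≤∣p─q∣+∣q─r∣ p q r)
∣p─r∣≤∣p─q∣+∣q─r∣ (outside ∷ p) (inside  ∷ q) (inside  ∷ r) = ∣p─r∣≤∣p─q∣+∣q─r∣ p q r
∣p─r∣≤∣p─q∣+∣q─r∣ (outside ∷ p) (inside  ∷ q) (outside ∷ r) =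
  ≤-trans (∣p─r∣≤∣p─q∣+∣q─r∣ p q r) (+-monoʳ-≤ ∣ p ─ q ∣ (n≤1+n _))
∣p─r∣≤∣p─q∣+∣q─r∣ (outside ∷ p) (outside ∷ q) (inside  ∷ r) = ∣p─r∣≤∣p─q∣+∣q─r∣ p q r
∣p─r∣≤∣p─q∣+∣q─r∣ (outside ∷ p) (outside ∷ q) (outside ∷ r) = ∣p─r∣≤∣p─q∣+∣q─r∣ p q r

∣p─p∣≡0 : (p : Subset n) → ∣ p ─ p ∣ ≡ 0
∣p─p∣≡0 []            = refl
∣p─p∣≡0 (inside  ∷ p) = ∣p─p∣≡0 p
∣p─p∣≡0 (outside ∷ p) = ∣p─p∣≡0 p

∣⊥─p∣≡0 : (p : Subset n) → ∣ ⊥ ─ p ∣ ≡ 0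
∣⊥─p∣≡0 {n} p = n≤0⇒n≡0 (≤-trans (∣p─q∣≤∣p∣ ⊥ p) (≤-reflexive (∣⊥∣≡0 n)))

∣p─q∣≡0⇒∣q─p∣≡0⇒p≡q : (p q : Subset n) → ∣ p ─ q ∣ ≡ 0 → ∣ q ─ p ∣ ≡ 0 → p ≡ q
∣p─q∣≡0⇒∣q─p∣≡0⇒p≡q []            []            _  _  = refl
∣p─q∣≡0⇒∣q─p∣≡0⇒p≡q (inside  ∷ p) (inside  ∷ q) pq qp = cong (inside ∷_) (∣p─q∣≡0⇒∣q─p∣≡0⇒p≡q p q pq qp)
∣p─q∣≡0⇒∣q─p∣≡0⇒p≡q (outside ∷ p) (outside ∷ q) pq qp = cong (outside ∷_) (∣p─q∣≡0⇒∣q─p∣≡0⇒p≡q p q pq qp)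

Agree : Subset n → Subset n → Subset n → Set
Agree R x y = R ∩ x ≡ R ∩ y

agree-extend : (R S x y : Subset n) → Agree R x y → Agree (S ─ R) x y → Agree S x y
agree-extend []            []      []       []       _  _   = refl
agree-extend (inside  ∷ R) (s ∷ S) (x ∷ xs) (y ∷ ys) eq eq′ =
  cong₂ _∷_ (cong (s ∧_) (∷-injectiveˡ eq)) (agree-extend R S xs ys (∷-injectiveʳ eq) (∷-injectiveʳ eq′))
agree-extend (outside ∷ R) (s ∷ S) (x ∷ xs) (y ∷ ys) eq eq′ =
  cong₂ _∷_ (∷-injectiveˡ eq′) (agree-extend R S xs ys (∷-injectiveʳ eq) (∷-injectiveʳ eq′))

agree⇒─-cancel : (R x y : Subset n) → Agree R x y → (y ─ R) ─ (x ─ R) ≡ y ─ x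
agree⇒─-cancel []            []      []       _  = refl
agree⇒─-cancel (inside  ∷ R) (inside  ∷ xs) (inside  ∷ ys) eq =
  cong (outside ∷_) (agree⇒─-cancel R xs ys (∷-injectiveʳ eq))
agree⇒─-cancel (inside  ∷ R) (outside ∷ xs) (outside ∷ ys) eq =
  cong (outside ∷_) (agree⇒─-cancel R xs ys (∷-injectiveʳ eq))
agree⇒─-cancel (inside  ∷ R) (inside  ∷ xs) (outside ∷ ys) eq with () ← ∷-injectiveˡ eq
agree⇒─-cancel (inside  ∷ R) (outside ∷ xs) (inside  ∷ ys) eq with () ← ∷-injectiveˡ eq
agree⇒─-cancel (outside ∷ R) (inside  ∷ xs) (y       ∷ ys) eq =
  cong (outside ∷_) (agree⇒─-cancel R xs ys (∷-injectiveʳ eq))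
agree⇒─-cancel (outside ∷ R) (outside ∷ xs) (y       ∷ ys) eq =
  cong (y ∷_) (agree⇒─-cancel R xs ys (∷-injectiveʳ eq))

singletons : Subset n → List (Subset n)
singletons []            = []
singletons (inside  ∷ D) = (inside ∷ ⊥) ∷ map (outside ∷_) (singletons D)
singletons (outside ∷ D) = map (outside ∷_) (singletons D)

length-singletons : (D : Subset n) → length (singletons D) ≡ ∣ D ∣
length-singletons []            = refl
length-singletons (inside  ∷ D) = cong suc (trans (List.length-map _ (singletons D)) (length-singletons D))
length-singletons (outside ∷ D) = trans (List.length-map _ (singletons D)) (length-singletons D)

singletons-agree : (D x y : Subset n) → (∀ {T} → T ∈ singletons D → response T x ≡ response T y) →
                   Agree D x y
singletons-agree []            []       []       _    = refl
singletons-agree (inside  ∷ D) (x ∷ xs) (y ∷ ys) same = cong₂ _∷_ head (singletons-agree D xs ys (same ∘ there ∘ ∈-map⁺ _))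
  where
  head : x ≡ y
  head = begin
    x                     ≡⟨ Bool.∨-identityʳ x ⟨
    x ∨ false             ≡⟨ cong (x ∨_) (response-⊥ xs) ⟨
    response (inside ∷ ⊥) (x ∷ xs) ≡⟨ same (here refl) ⟩
    y ∨ response ⊥ ys     ≡⟨ cong (y ∨_) (response-⊥ ys) ⟩
    y ∨ false             ≡⟨ Bool.∨-identityʳ y ⟩
    y                     ∎
    where open ≡-Reasoning
singletons-agree (outside ∷ D) (x ∷ xs) (y ∷ ys) same = cong (outside ∷_) (singletons-agree D xs ys (same ∘ ∈-map⁺ _))

-- Random tests

-- Each element lies in a test of `family o n` with multiplicity 1 and outside it with
-- multiplicity o: counting over the family is the uniform distribution on random tests
-- containing each element independently with probability 1/(1 + o).
family : ℕ → (n : ℕ) → List (Subset n)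
family o zero    = [ [] ]
family o (suc n) = map (inside ∷_) (family o n) ++ concat (replicate o (map (outside ∷_) (family o n)))

count-family : ∀ o n (p : Subset (suc n) → Bool) →
               count p (family o (suc n)) ≡ count (p ∘ (inside ∷_)) (family o n) + o * count (p ∘ (outside ∷_)) (family o n)
count-family o n p = begin
  count p (map (inside ∷_) F ++ concat (replicate o (map (outside ∷_) F)))
    ≡⟨ count-++ p (map (inside ∷_) F) _ ⟩
  count p (map (inside ∷_) F) + count p (concat (replicate o (map (outside ∷_) F)))
    ≡⟨ cong₂ _+_ (count-map p _ F) (trans (count-concat-replicate p o _) (cong (o *_) (count-map p _ F))) ⟩
  count (p ∘ (inside ∷_)) F + o * count (p ∘ (outside ∷_)) F
    ∎
  where open ≡-Reasoning; F = family o n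

length-family : ∀ o n → length (family o (suc n)) ≡ suc o * length (family o n)
length-family o n = begin
  length (family o (suc n))                   ≡⟨ count-true (family o (suc n)) ⟨
  count (λ _ → true) (family o (suc n))       ≡⟨ count-family o n (λ _ → true) ⟩
  count (λ _ → true) F + o * count (λ _ → true) F ≡⟨ cong (λ c → c + o * c) (count-true F) ⟩
  suc o * length F                            ∎
  where open ≡-Reasoning; F = family o n

avoids : Subset n → Subset n → Bool
avoids A T = not (response T A)

separates : Subset n → Subset n → Subset n → Bool
separates A B T = avoids A T ∧ response T B

separates-pair : Subset n × Subset n → Subset n → Bool
separates-pair (A , B) = separates A B

separates-true : ∀ (A B T : Subset n) → separates A B T ≡ true → response T A ≡ false × response T B ≡ true
separates-true A B T hit with response T A | response T B
... | false | true = refl , refl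

family-nonZero : ∀ o n → NonZero (length (family o n))
family-nonZero o zero    = _
family-nonZero o (suc n) = subst NonZero (sym (length-family o n)) (m*n≢0 (suc o) _ {{_}} {{family-nonZero o n}})

private
  scale : ∀ m x y z → x * y ≤ z → x * (m * y) ≤ m * z
  scale m x y z xy≤z = begin
    x * (m * y) ≡⟨ x*[m*y]≡m*[x*y] x m y ⟩
    m * (x * y) ≤⟨ *-monoʳ-≤ m xy≤z ⟩
    m * z       ∎
    where
    open ≤-Reasoning
    x*[m*y]≡m*[x*y] : ∀ x m y → x * (m * y) ≡ m * (x * y)
    x*[m*y]≡m*[x*y] = solve-∀

  bernoulli-step : ∀ t o F u → suc t * F ≤ suc o * u → u ≤ F → t * F ≤ o * u
  bernoulli-step t o F u ih u≤F = +-cancelʳ-≤ F (t * F) (o * u) (begin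
    t * F + F ≡⟨ +-comm (t * F) F ⟩
    suc t * F ≤⟨ ih ⟩
    u + o * u ≤⟨ +-monoˡ-≤ (o * u) u≤F ⟩
    F + o * u ≡⟨ +-comm F (o * u) ⟩
    o * u + F ∎)
    where open ≤-Reasoning

  separate-step-avoid : ∀ j t o F g → t ≤ o → j * suc t * F ≤ suc o * (suc o * g) →
                        j * t * (suc o * F) ≤ suc o * (suc o * (o * g))
  separate-step-avoid j t o F g t≤o ih = begin
    j * t * (suc o * F)      ≡⟨ lhs j t o F ⟩
    (t + t * o) * (j * F)    ≤⟨ *-monoˡ-≤ (j * F) (+-monoˡ-≤ (t * o) t≤o) ⟩
    (o + t * o) * (j * F)    ≡⟨ mid j t o F ⟩
    o * (j * suc t * F)      ≤⟨ *-monoʳ-≤ o ih ⟩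
    o * (suc o * (suc o * g))  ≡⟨ rhs o g ⟩
    suc o * (suc o * (o * g))  ∎
    where
    open ≤-Reasoning
    lhs : ∀ j t o F → j * t * (suc o * F) ≡ (t + t * o) * (j * F)
    lhs = solve-∀
    mid : ∀ j t o F → (o + t * o) * (j * F) ≡ o * (j * suc t * F)
    mid = solve-∀
    rhs : ∀ o g → o * (suc o * (suc o * g)) ≡ suc o * (suc o * (o * g))
    rhs = solve-∀

  -- With m = 1 + o = α + (1 + j) + t, the slack is nonnegative:
  -- m (1 + j + t) + o j (1 + t) − (1 + j) t m = α (2j + 1) + 2j² + 2j + jt + t + 1.
  separate-step-hit : ∀ α j t o F u g → α + j + t ≡ o → j * suc t * F ≤ suc o * (suc o * g) →
                      (suc j + t) * F ≤ suc o * u → suc j * t * (suc o * F) ≤ suc o * (suc o * (u + o * g))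
  separate-step-hit α j t _ F u g refl ih₁ ih₂ = begin
    suc j * t * (m * F)
      ≤⟨ m≤m+n _ (F * (α * (2 * j + 1) + 2 * j * j + 2 * j + j * t + t + 1)) ⟩
    suc j * t * (m * F) + F * (α * (2 * j + 1) + 2 * j * j + 2 * j + j * t + t + 1)
      ≡⟨ slack α j t F ⟩
    m * ((suc j + t) * F) + o * (j * suc t * F)
      ≤⟨ +-mono-≤ (*-monoʳ-≤ m ih₂) (*-monoʳ-≤ o ih₁) ⟩
    m * (m * u) + o * (m * (m * g))
      ≡⟨ collect u g o ⟩
    m * (m * (u + o * g))
      ∎
    where
    open ≤-Reasoning
    o = α + j + t
    m = suc o
    slack : ∀ α j t F → suc j * t * (suc (α + j + t) * F) + F * (α * (2 * j + 1) + 2 * j * j + 2 * j + j * t + t + 1)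
                      ≡ suc (α + j + t) * ((suc j + t) * F) + (α + j + t) * (j * suc t * F)
    slack = solve-∀
    collect : ∀ u g o → suc o * (suc o * u) + o * (suc o * (suc o * g)) ≡ suc o * (suc o * (u + o * g))
    collect = solve-∀

-- Bernoulli's inequality (1 − 1/m)^|A| ≥ 1 − |A|/m, for m = 1 + o.
avoid-bound : ∀ o (A : Subset n) t → ∣ A ∣ + t ≡ suc o →
              t * length (family o n) ≤ suc o * count (avoids A) (family o n)
avoid-bound o []            t eq = ≤-reflexive (cong (_* 1) eq)
avoid-bound {suc n} o (outside ∷ A) t eq = begin
  t * length (family o (suc n))                    ≡⟨ cong (t *_) (length-family o n) ⟩
  t * (suc o * length (family o n))                ≤⟨ scale (suc o) t _ _ (avoid-bound o A t eq) ⟩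
  suc o * (suc o * count (avoids A) (family o n))  ≡⟨ cong (suc o *_) (count-family o n (avoids (outside ∷ A))) ⟨
  suc o * count (avoids (outside ∷ A)) (family o (suc n)) ∎
  where open ≤-Reasoning
avoid-bound {suc n} o (inside ∷ A) t eq = begin
  t * length (family o (suc n))                    ≡⟨ cong (t *_) (length-family o n) ⟩
  t * (suc o * length (family o n))                ≤⟨ scale (suc o) t _ _ (bernoulli-step t o _ _ ih (count≤length (avoids A) (family o n))) ⟩
  suc o * (o * count (avoids A) (family o n))      ≡⟨ cong (suc o *_) (trans (count-family o n (avoids (inside ∷ A)))
                                                        (cong (_+ o * count (avoids A) (family o n)) (count-false (family o n)))) ⟨
  suc o * count (avoids (inside ∷ A)) (family o (suc n)) ∎
  where
  open ≤-Reasoning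
  ih = avoid-bound o A (suc t) (trans (+-suc ∣ A ∣ t) eq)

-- Pr[T avoids A and meets B] ≥ |B ─ A| (m − |A| − |B ─ A|) / m², for m = 1 + o.
separate-bound : ∀ o (A B : Subset n) t → ∣ A ∣ + ∣ B ─ A ∣ + t ≡ suc o →
                 ∣ B ─ A ∣ * t * length (family o n) ≤ suc o * (suc o * count (separates A B) (family o n))
separate-bound o [] [] t eq = z≤n
separate-bound {suc n} o (outside ∷ A) (outside ∷ B) t eq = begin
  ∣ B ─ A ∣ * t * length (family o (suc n))             ≡⟨ cong (∣ B ─ A ∣ * t *_) (length-family o n) ⟩
  ∣ B ─ A ∣ * t * (suc o * length (family o n))         ≤⟨ scale (suc o) (∣ B ─ A ∣ * t) (length F) _ (separate-bound o A B t eq) ⟩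
  suc o * (suc o * (suc o * count (separates A B) F))   ≡⟨ cong (λ c → suc o * (suc o * c)) (count-family o n _) ⟨
  suc o * (suc o * count (separates (outside ∷ A) (outside ∷ B)) (family o (suc n))) ∎
  where open ≤-Reasoning; F = family o n
separate-bound {suc n} o (inside ∷ A) (β ∷ B) t eq = begin
  ∣ B ─ A ∣ * t * length (family o (suc n))             ≡⟨ cong (∣ B ─ A ∣ * t *_) (length-family o n) ⟩
  ∣ B ─ A ∣ * t * (suc o * length F)                    ≤⟨ separate-step-avoid ∣ B ─ A ∣ t o (length F) _ t≤o ih ⟩
  suc o * (suc o * (o * count (separates A B) F))       ≡⟨ cong (λ c → suc o * (suc o * c)) count-eq ⟨
  suc o * (suc o * count (separates (inside ∷ A) (β ∷ B)) (family o (suc n))) ∎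
  where
  open ≤-Reasoning
  F = family o n
  ih = separate-bound o A B (suc t) (trans (+-suc (∣ A ∣ + ∣ B ─ A ∣) t) eq)
  t≤o : t ≤ o
  t≤o = ≤-trans (m≤n+m t (∣ A ∣ + ∣ B ─ A ∣)) (≤-reflexive (suc-injective eq))
  count-eq : count (separates (inside ∷ A) (β ∷ B)) (family o (suc n)) ≡ o * count (separates A B) F
  count-eq = trans (count-family o n _) (cong (_+ o * count (separates A B) F) (count-false F))
separate-bound {suc n} o (outside ∷ A) (inside ∷ B) t eq = begin
  suc j * t * length (family o (suc n))                 ≡⟨ cong (suc j * t *_) (length-family o n) ⟩
  suc j * t * (suc o * length F)                        ≤⟨ separate-step-hit ∣ A ∣ j t o (length F) _ _ (suc-injective eq′) ih-separate ih-avoid ⟩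
  suc o * (suc o * (count (avoids A) F + o * count (separates A B) F))
    ≡⟨ cong (λ c → suc o * (suc o * c)) count-eq ⟨
  suc o * (suc o * count (separates (outside ∷ A) (inside ∷ B)) (family o (suc n))) ∎
  where
  open ≤-Reasoning
  F = family o n
  j = ∣ B ─ A ∣
  eq′ : suc (∣ A ∣ + j + t) ≡ suc o
  eq′ = trans (sym (cong (_+ t) (+-suc ∣ A ∣ j))) eq
  ih-separate = separate-bound o A B (suc t) (trans (+-suc (∣ A ∣ + j) t) eq′)
  ih-avoid = avoid-bound o A (suc j + t) (trans (sym (+-assoc ∣ A ∣ (suc j) t)) eq)
  count-eq : count (separates (outside ∷ A) (inside ∷ B)) (family o (suc n)) ≡ count (avoids A) F + o * count (separates A B) F
  count-eq = trans (count-family o n _) (cong (_+ o * count (separates A B) F) (count-cong (λ T → Bool.∧-identityʳ _) F))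

-- With m = 4 (1 + a) we have m − |A| − |B ─ A| ≥ 2 (1 + a), so the bound above is at least |B ─ A| / (8 (1 + a)).
separation-density : ∀ a k (A B : Subset n) → ∣ A ∣ ≤ suc a → ∣ B ∣ ≤ suc a → k ≤ ∣ B ─ A ∣ →
                     k * length (family (4 * a + 3) n) ≤ 8 * suc a * count (separates A B) (family (4 * a + 3) n)
separation-density {n} a k A B ∣A∣≤ ∣B∣≤ k≤j = *-cancelʳ-≤ _ _ (2 * suc a) (begin
  k * F * (2 * suc a)         ≡⟨ *-comm-middle k F (2 * suc a) ⟩
  k * (2 * suc a) * F         ≤⟨ *-monoˡ-≤ F (*-mono-≤ k≤j 2a≤t) ⟩
  j * t * F                   ≤⟨ separate-bound o A B t α+j+t≡m ⟩
  suc o * (suc o * g)         ≡⟨ regroup a g ⟩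
  8 * suc a * g * (2 * suc a) ∎)
  where
  open ≤-Reasoning
  o = 4 * a + 3
  F = length (family o n)
  g = count (separates A B) (family o n)
  j = ∣ B ─ A ∣
  t = suc o ∸ (∣ A ∣ + j)
  α+j≤2a : ∣ A ∣ + j ≤ 2 * suc a
  α+j≤2a = ≤-trans (+-mono-≤ ∣A∣≤ (≤-trans (∣p─q∣≤∣p∣ B A) ∣B∣≤)) (≤-reflexive (cong (suc a +_) (sym (+-identityʳ (suc a)))))
  m≡2a+2a : suc o ≡ 2 * suc a + 2 * suc a
  m≡2a+2a = split a
    where split : ∀ a → suc (4 * a + 3) ≡ 2 * suc a + 2 * suc a
          split = solve-∀
  α+j+t≡m : ∣ A ∣ + j + t ≡ suc o
  α+j+t≡m = m+[n∸m]≡n (≤-trans α+j≤2a (≤-trans (m≤m+n _ _) (≤-reflexive (sym m≡2a+2a))))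
  2a≤t : 2 * suc a ≤ t
  2a≤t = begin
    2 * suc a                           ≡⟨ m+n∸m≡n (2 * suc a) (2 * suc a) ⟨
    2 * suc a + 2 * suc a ∸ 2 * suc a   ≤⟨ ∸-monoʳ-≤ _ α+j≤2a ⟩
    2 * suc a + 2 * suc a ∸ (∣ A ∣ + j) ≡⟨ cong (_∸ (∣ A ∣ + j)) m≡2a+2a ⟨
    t                                   ∎
  *-comm-middle : ∀ x y z → x * y * z ≡ x * z * y
  *-comm-middle = solve-∀
  regroup : ∀ a g → suc (4 * a + 3) * (suc (4 * a + 3) * g) ≡ 8 * suc a * g * (2 * suc a)
  regroup = solve-∀

-- Greedy covering

module Greedy {A B : Set} (covers : A → B → Bool) (Ts : List B) .{{_ : NonZero (length Ts)}} (t₀ : B) where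

  coverage : List A → B → ℕ
  coverage Ps t = count (λ p → covers p t) Ps

  best : List A → B
  best Ps = argmax (coverage Ps) t₀ Ts

  uncovered : B → List A → List A
  uncovered t = filter (λ p → covers p t Bool.≟ false)

  greedy : ℕ → List A → List B
  greedy zero    Ps = []
  greedy (suc i) Ps = best Ps ∷ greedy i (uncovered (best Ps) Ps)

  leftover : ℕ → List A → List A
  leftover zero    Ps = Ps
  leftover (suc i) Ps = leftover i (uncovered (best Ps) Ps)

  length-greedy : ∀ i Ps → length (greedy i Ps) ≡ i
  length-greedy zero    Ps = refl
  length-greedy (suc i) Ps = cong suc (length-greedy i _)

  leftover-+ : ∀ i i′ Ps → leftover (i + i′) Ps ≡ leftover i′ (leftover i Ps)
  leftover-+ zero    i′ Ps = refl
  leftover-+ (suc i) i′ Ps = leftover-+ i i′ _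

  length-leftover : ∀ i Ps → length (leftover i Ps) ≤ length Ps
  length-leftover zero    Ps = ≤-refl
  length-leftover (suc i) Ps = ≤-trans (length-leftover i _) (List.length-filter _ Ps)

  leftover-All : ∀ {Q : A → Set} i Ps → All Q Ps → All Q (leftover i Ps)
  leftover-All zero    Ps qs = qs
  leftover-All (suc i) Ps qs = leftover-All i _ (All.filter⁺ _ qs)

  covered-or-leftover : ∀ i {p} Ps → p ∈ Ps → Any (λ t → covers p t ≡ true) (greedy i Ps) ⊎ p ∈ leftover i Ps
  covered-or-leftover zero    Ps p∈ = inj₂ p∈
  covered-or-leftover (suc i) {p} Ps p∈ with covers p (best Ps) in hit
  ... | true  = inj₁ (here hit)
  ... | false = Sum.map₁ there (covered-or-leftover i _ (∈-filter⁺ (λ q → covers q (best Ps) Bool.≟ false) p∈ hit))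

  module _ (k c : ℕ) .{{_ : NonZero c}} where

    Dense : A → Set
    Dense p = k * length Ts ≤ c * count (covers p) Ts

    best-coverage : ∀ Ps → All Dense Ps → k * length Ps ≤ c * coverage Ps (best Ps)
    best-coverage Ps dense = *-cancelˡ-≤ (length Ts) (begin
      length Ts * (k * length Ps)                       ≡⟨ rearrange (length Ts) k (length Ps) ⟩
      length Ps * (k * length Ts)                       ≤⟨ *-sum-map-≥ (λ p → count (covers p) Ts) c Ps dense ⟩
      c * sum (map (λ p → count (covers p) Ts) Ps)      ≡⟨ cong (c *_) (sum-map-swap (λ p t → if covers p t then 1 else 0) Ps Ts) ⟨
      c * sum (map (coverage Ps) Ts)                    ≤⟨ *-monoʳ-≤ c (sum-map-≤ (coverage Ps) Ts (f[xs]≤f[argmax] t₀ Ts)) ⟩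
      c * (length Ts * coverage Ps (best Ps))           ≡⟨ *-left-comm c (length Ts) _ ⟩
      length Ts * (c * coverage Ps (best Ps))           ∎)
      where
      open ≤-Reasoning
      rearrange : ∀ x y z → x * (y * z) ≡ z * (y * x)
      rearrange = solve-∀
      *-left-comm : ∀ x y z → x * (y * z) ≡ y * (x * z)
      *-left-comm = solve-∀

    greedy-step : ∀ Ps → All Dense Ps → c * length (uncovered (best Ps) Ps) + k * length Ps ≤ c * length Ps
    greedy-step Ps dense = begin
      c * length (uncovered t Ps) + k * length Ps         ≤⟨ +-monoʳ-≤ _ (best-coverage Ps dense) ⟩
      c * length (uncovered t Ps) + c * coverage Ps t     ≡⟨ *-distribˡ-+ c _ _ ⟨
      c * (length (uncovered t Ps) + coverage Ps t)       ≡⟨ cong (c *_) (length-filter-false+count (λ p → covers p t) Ps) ⟩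
      c * length Ps                                       ∎
      where open ≤-Reasoning; t = best Ps

    -- Each round removes a fraction k / c of its input, which is at least as long as the final leftover.
    leftover-decay : ∀ i Ps → All Dense Ps → (c + i * k) * length (leftover i Ps) ≤ c * length Ps
    leftover-decay zero    Ps dense = ≤-reflexive (cong (_* length Ps) (+-identityʳ c))
    leftover-decay (suc i) Ps dense = begin
      (c + (k + i * k)) * x                 ≡⟨ split c k (i * k) x ⟩
      (c + i * k) * x + k * x               ≤⟨ +-mono-≤ (leftover-decay i Ps′ (All.filter⁺ _ dense))
                                                        (*-monoʳ-≤ k (≤-trans (length-leftover i Ps′) (List.length-filter _ Ps))) ⟩
      c * length Ps′ + k * length Ps        ≤⟨ greedy-step Ps dense ⟩
      c * length Ps                         ∎
      where
      open ≤-Reasoning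
      Ps′ = uncovered (best Ps) Ps
      x = length (leftover i Ps′)
      split : ∀ c k ik x → (c + (k + ik)) * x ≡ (c + ik) * x + k * x
      split = solve-∀

    leftover-halves : ∀ r Ps → c ≤ r * k → All Dense Ps →
                      2 * length (leftover r Ps) ≤ length Ps
    leftover-halves r Ps c≤rk dense = *-cancelˡ-≤ c (begin
      c * (2 * x)        ≡⟨ double c x ⟩
      (c + c) * x        ≤⟨ *-monoˡ-≤ x (+-monoʳ-≤ c c≤rk) ⟩
      (c + r * k) * x    ≤⟨ leftover-decay r Ps dense ⟩
      c * length Ps      ∎)
      where
      open ≤-Reasoning
      x = length (leftover r Ps)
      double : ∀ c x → c * (2 * x) ≡ (c + c) * x
      double = solve-∀

    leftover-exhausted : ∀ r t Ps → c ≤ r * k → All Dense Ps →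
                         length Ps < 2 ^ t → leftover (t * r) Ps ≡ []
    leftover-exhausted r zero    []      _    _     _          = refl
    leftover-exhausted r zero    (_ ∷ _) _    _     (s≤s ())
    leftover-exhausted r (suc t) Ps      c≤rk dense ∣Ps∣<2^[1+t] = begin
      leftover (r + t * r) Ps          ≡⟨ leftover-+ r (t * r) Ps ⟩
      leftover (t * r) (leftover r Ps) ≡⟨ leftover-exhausted r t _ c≤rk (leftover-All r Ps dense) halved ⟩
      []                               ∎
      where
      open ≡-Reasoning
      halved : length (leftover r Ps) < 2 ^ t
      halved = *-cancelˡ-< 2 _ _ (≤-<-trans (leftover-halves r Ps c≤rk dense) ∣Ps∣<2^[1+t])

    greedy-covers : ∀ r t Ps → c ≤ r * k → All Dense Ps → length Ps < 2 ^ t →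
                    ∀ {p} → p ∈ Ps → Any (λ s → covers p s ≡ true) (greedy (t * r) Ps)
    greedy-covers r t Ps c≤rk dense small p∈ with covered-or-leftover (t * r) Ps p∈
    ... | inj₁ covered = covered
    ... | inj₂ p∈left with () ← subst (_ ∈_) (leftover-exhausted r t Ps c≤rk dense small) p∈left

-- The algorithm

runFrom-replicate-suc : ∀ k h (f : History → List (Subset n)) e →
                        runFrom h (Vec.replicate (suc k) f) e ≡
                        runFrom h (Vec.replicate k f) e ++ [ map (λ T → response T e) (f (runFrom h (Vec.replicate k f) e)) ]
runFrom-replicate-suc zero    h f e = refl
runFrom-replicate-suc (suc k) h f e = runFrom-replicate-suc k _ f e

testsFrom-replicate-suc : ∀ k h (f : History → List (Subset n)) e →
                          testsFrom h (Vec.replicate (suc k) f) e ≡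
                          testsFrom h (Vec.replicate k f) e + length (f (runFrom h (Vec.replicate k f) e))
testsFrom-replicate-suc zero    h f e = +-comm (length (f h)) 0
testsFrom-replicate-suc (suc k) h f e =
  trans (cong (length (f h) +_) (testsFrom-replicate-suc k _ f e)) (sym (+-assoc (length (f h)) _ _))

module Staged {n : ℕ} (E : List (Subset n)) (b : ℕ → ℕ) where

  L : ℕ
  L = ⌈log₂ length E ⌉

  record State : Set where
    constructor state
    field
      stage      : ℕ
      candidates : List (Subset n)
      reference  : Subset n
  open State public

  representative : List (Subset n) → Subset n
  representative []      = ⊥
  representative (e ∷ _) = e

  representative-∈ : ∀ {e C} → e ∈ C → representative C ∈ C
  representative-∈ (here _)  = here refl
  representative-∈ (there _) = here refl

  -- At stage 0 no anchor is used: testing the elements of a candidate individually could cost d tests.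
  anchor : State → Subset n
  anchor (state zero    C R) = ⊥
  anchor (state (suc _) C R) = representative C

  Separable : ℕ → Subset n × Subset n → Set
  Separable j (A , B) = ∣ A ∣ ≤ suc (2 * b j) × ∣ B ∣ ≤ suc (2 * b j) × b (suc j) ≤ ∣ B ─ A ∣

  separable? : ∀ j → Decidable (Separable j)
  separable? j (A , B) = ∣ A ∣ ≤? suc (2 * b j) ×-dec ∣ B ∣ ≤? suc (2 * b j) ×-dec b (suc j) ≤? ∣ B ─ A ∣

  reduced : State → List (Subset n)
  reduced σ = map (_─ anchor σ) (candidates σ)

  requirements : State → List (Subset n × Subset n)
  requirements σ = filter (separable? (stage σ)) (cartesianProduct (reduced σ) (reduced σ))

  -- Remainders have at most a = 2 b_j + 1 elements; tests contain each element with probability 1/(4a).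
  outs : ℕ → ℕ
  outs j = 4 * (2 * b j) + 3

  rounds : ℕ → ℕ
  rounds j = 32 * (b j div b (suc j))

  module Separation (j : ℕ) = Greedy separates-pair (family (outs j) n) {{family-nonZero (outs j) n}} ⊥

  separating : State → List (Subset n)
  separating σ = Separation.greedy (stage σ) ((L + L) * rounds (stage σ)) (requirements σ)

  stageTests : State → List (Subset n)
  stageTests σ = singletons (anchor σ ─ reference σ) ++ map (_∩ ∁ (anchor σ)) (separating σ)

  responses : List (Subset n) → Subset n → List Bool
  responses Ts e = map (λ T → response T e) Ts

  update : State → List Bool → State
  update σ rs = state (suc (stage σ)) consistent (anchor σ)
    where consistent = filter (λ e → ≡-dec Bool._≟_ (responses (stageTests σ) e) rs) (candidates σ)

  stateAfter : History → State
  stateAfter = foldl update (state 0 E ⊥)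

  algorithm : (s : ℕ) → Algorithm n s
  algorithm s = mkAlg (Vec.replicate s (stageTests ∘ stateAfter)) (representative ∘ candidates ∘ stateAfter)

-- Correctness

sumTo-suc : ∀ k f → sumTo (suc k) f ≡ f 0 + sumTo k (f ∘ suc)
sumTo-suc zero    f = +-comm 0 (f 0)
sumTo-suc (suc k) f = trans (cong (_+ f (suc k)) (sumTo-suc k f)) (+-assoc (f 0) _ _)

n≤2^⌈log₂n⌉ : ∀ N → N ≤ 2 ^ ⌈log₂ N ⌉
n≤2^⌈log₂n⌉ = <-rec _ step
  where
  step : ∀ N → (∀ {M} → M < N → M ≤ 2 ^ ⌈log₂ M ⌉) → N ≤ 2 ^ ⌈log₂ N ⌉
  step zero            _  = z≤n
  step (suc zero)      _  = s≤s z≤n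
  step N@(suc (suc k)) ih = begin
    N                                 ≡⟨ ⌊n/2⌋+⌈n/2⌉≡n N ⟨
    ⌊ N /2⌋ + ⌈ N /2⌉                 ≤⟨ +-monoˡ-≤ ⌈ N /2⌉ (⌊n/2⌋≤⌈n/2⌉ N) ⟩
    ⌈ N /2⌉ + ⌈ N /2⌉                 ≤⟨ +-mono-≤ half half ⟩
    2 ^ l + 2 ^ l                     ≡⟨ cong (2 ^ l +_) (+-identityʳ (2 ^ l)) ⟨
    2 ^ suc l                         ≡⟨ cong (2 ^_) suc[l]≡⌈log₂N⌉ ⟩
    2 ^ ⌈log₂ N ⌉                     ∎
    where
    open ≤-Reasoning
    l = ⌈log₂ ⌈ N /2⌉ ⌉
    half : ⌈ N /2⌉ ≤ 2 ^ l
    half = ih {⌈ N /2⌉} (⌈n/2⌉<n k)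
    suc[l]≡⌈log₂N⌉ : suc l ≡ ⌈log₂ N ⌉
    suc[l]≡⌈log₂N⌉ = trans (cong suc (⌈log₂⌈n/2⌉⌉≡⌈log₂n⌉∸1 N))
                           (m+[n∸m]≡n {1} {⌈log₂ N ⌉} (⌈log₂⌉-mono-≤ {2} {N} (s≤s (s≤s z≤n))))

rounds-enough : ∀ B K → 1 ≤ K → K < B → 8 * suc (2 * B) ≤ 32 * (B div K) * K
rounds-enough B K@(suc _) _ K<B = begin
  8 * suc (2 * B)       ≤⟨ 8[1+2B]≤16[1+B] B ⟩
  16 * suc B            ≤⟨ *-monoʳ-≤ 16 1+B≤[1+q]K ⟩
  16 * (suc q * K)      ≤⟨ *-monoʳ-≤ 16 (*-monoˡ-≤ K 1+q≤2q) ⟩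
  16 * (2 * q * K)      ≡⟨ regroup q K ⟩
  32 * q * K            ∎
  where
  open ≤-Reasoning
  q = B / K
  1+B≤[1+q]K : suc B ≤ suc q * K
  1+B≤[1+q]K = begin
    suc B                 ≡⟨ cong suc (m≡m%n+[m/n]*n B K) ⟩
    suc (B % K + q * K)   ≤⟨ +-monoˡ-≤ (q * K) (m%n<n B K) ⟩
    K + q * K             ∎
  1+q≤2q : suc q ≤ 2 * q
  1+q≤2q = ≤-trans (≤-reflexive (+-comm 1 q)) (+-monoʳ-≤ q (≤-trans (m≥n⇒m/n>0 (<⇒≤ K<B)) (≤-reflexive (sym (+-identityʳ q)))))
  8[1+2B]≤16[1+B] : ∀ B → 8 * suc (2 * B) ≤ 16 * suc B
  8[1+2B]≤16[1+B] B = ≤-trans (m≤m+n _ 8) (≤-reflexive (expand B))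
    where expand : ∀ B → 8 * suc (2 * B) + 8 ≡ 16 * suc B
          expand = solve-∀
  regroup : ∀ q K → 16 * (2 * q * K) ≡ 32 * q * K
  regroup = solve-∀

module Correctness {n d s : ℕ} {E : List (Subset n)} {b : ℕ → ℕ}
  (E-bounded : All (λ e → ∣ e ∣ ≤ d) E) (b0≡d : b 0 ≡ d)
  (b-decreasing : ∀ i → i < s → b (suc i) < b i) (bs≡1 : b s ≡ 1)
  {e* : Subset n} (e*∈E : e* ∈ E) where

  open Staged E b

  b-positive : ∀ i → i ≤ s → 1 ≤ b i
  b-positive i i≤s = ≤-trans (≤-reflexive (sym bs≡1)) (bs≤b (s ∸ i) i (m+[n∸m]≡n i≤s))
    where
    bs≤b : ∀ k i → i + k ≡ s → b s ≤ b i
    bs≤b zero    i refl = ≤-reflexive (cong b (+-identityʳ i))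
    bs≤b (suc k) i refl = ≤-trans (bs≤b k (suc i) (sym (+-suc i k)))
                                  (<⇒≤ (b-decreasing i (≤-trans (s≤s (m≤m+n i k)) (≤-reflexive (sym (+-suc i k))))))

  -- How far candidates may be from e* at the start of a stage: 0 after the last one.
  radius : ℕ → ℕ
  radius zero    = b zero
  radius (suc j) = pred (b (suc j))

  radius≤b : ∀ j → radius j ≤ b j
  radius≤b zero    = ≤-refl
  radius≤b (suc j) = pred[n]≤n

  previous : ℕ → ℕ
  previous zero    = 0
  previous (suc j) = b j

  budget : ℕ → ℕ
  budget j = (b j div b (suc j)) * L + previous j

  e*-bounded : ∣ e* ∣ ≤ d
  e*-bounded = All.lookup E-bounded e*∈E

  record Invariant (σ : State) : Set where
    field
      e*-candidate    : e* ∈ candidates σ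
      few-candidates  : length (candidates σ) ≤ length E
      close           : ∀ {e} → e ∈ candidates σ → ∣ e ─ e* ∣ ≤ radius (stage σ) × ∣ e* ─ e ∣ ≤ radius (stage σ)
      agree           : ∀ {e} → e ∈ candidates σ → Agree (reference σ) e e*
      reference-close : ∣ e* ─ reference σ ∣ ≤ b (pred (stage σ))

  ∣e*─⊥∣≤b0 : ∣ e* ─ ⊥ ∣ ≤ b 0
  ∣e*─⊥∣≤b0 = subst₂ _≤_ (cong ∣_∣ (sym (p─⊥≡p e*))) (sym b0≡d) e*-bounded

  initial-invariant : Invariant (state 0 E ⊥)
  initial-invariant = record
    { e*-candidate    = e*∈E
    ; few-candidates  = ≤-refl
    ; close           = λ {e} e∈E → ≤-trans (∣p─q∣≤∣p∣ e e*) (subst (_ ≤_) (sym b0≡d) (All.lookup E-bounded e∈E))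
                                  , ≤-trans (∣p─q∣≤∣p∣ e* e) (subst (_ ≤_) (sym b0≡d) e*-bounded)
    ; agree           = λ {e} _ → trans (∩-zeroˡ e) (sym (∩-zeroˡ e*))
    ; reference-close = ∣e*─⊥∣≤b0
    }

  anchor-close : ∀ j C R → Invariant (state j C R) → ∣ e* ─ anchor (state j C R) ∣ ≤ b j
  anchor-close zero    C R inv = ∣e*─⊥∣≤b0
  anchor-close (suc j) C R inv = ≤-trans (proj₂ (close (representative-∈ e*-candidate))) (radius≤b (suc j))
    where open Invariant inv

  new-tests-few : ∀ j C R → Invariant (state j C R) → j < s → ∣ anchor (state j C R) ─ R ∣ ≤ 2 * previous j
  new-tests-few zero    C R inv _   = ≤-reflexive (∣⊥─p∣≡0 R)
  new-tests-few (suc j) C R inv j<s = begin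
    ∣ A₀ ─ R ∣                   ≤⟨ ∣p─r∣≤∣p─q∣+∣q─r∣ A₀ e* R ⟩
    ∣ A₀ ─ e* ∣ + ∣ e* ─ R ∣     ≤⟨ +-mono-≤ (≤-trans (proj₁ (close (representative-∈ e*-candidate))) (radius≤b (suc j))) reference-close ⟩
    b (suc j) + b j              ≤⟨ +-monoˡ-≤ (b j) (<⇒≤ (b-decreasing j (<⇒≤ j<s))) ⟩
    b j + b j                    ≡⟨ cong (b j +_) (+-identityʳ (b j)) ⟨
    2 * b j                      ∎
    where
    open ≤-Reasoning
    open Invariant inv
    A₀ = anchor (state (suc j) C R)

  advance : State → State
  advance σ = update σ (responses (stageTests σ) e*)

  module Stage (j : ℕ) (C : List (Subset n)) (R : Subset n) (inv : Invariant (state j C R)) (j<s : j < s) where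
    open Invariant inv

    σ = state j C R
    A₀ = anchor σ
    k = b (suc j)
    Ts = stageTests σ
    Ps = requirements σ
    C′ = candidates (advance σ)

    k-positive : 1 ≤ k
    k-positive = b-positive (suc j) j<s

    candidate-anchor-close : ∀ {e} → e ∈ C → ∣ e ─ A₀ ∣ ≤ suc (2 * b j)
    candidate-anchor-close {e} e∈C = begin
      ∣ e ─ A₀ ∣                ≤⟨ ∣p─r∣≤∣p─q∣+∣q─r∣ e e* A₀ ⟩
      ∣ e ─ e* ∣ + ∣ e* ─ A₀ ∣  ≤⟨ +-mono-≤ (≤-trans (proj₁ (close e∈C)) (radius≤b j)) (anchor-close j C R inv) ⟩
      b j + b j                 ≡⟨ cong (b j +_) (+-identityʳ (b j)) ⟨
      2 * b j                   ≤⟨ n≤1+n _ ⟩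
      suc (2 * b j)             ∎
      where open ≤-Reasoning

    consistent? = λ e → ≡-dec Bool._≟_ (responses Ts e) (responses Ts e*)

    survivor : ∀ {e} → e ∈ C′ → e ∈ C × (∀ {T} → T ∈ Ts → response T e ≡ response T e*)
    survivor e∈C′ = let e∈C , same = ∈-filter⁻ consistent? e∈C′ in e∈C , map-≡⇒≡ same

    e*-survives : e* ∈ C′
    e*-survives = ∈-filter⁺ consistent? e*-candidate refl

    survivor-agrees : ∀ {e} → e ∈ C′ → Agree A₀ e e*
    survivor-agrees e∈C′ = let e∈C , same = survivor e∈C′ in
      agree-extend R A₀ _ e* (agree e∈C) (singletons-agree (A₀ ─ R) _ e* (same ∘ ∈-++⁺ˡ))

    c = 8 * suc (2 * b j)

    open Separation j using (Dense; greedy-covers; length-greedy)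

    requirements-dense : All (Dense k c) Ps
    requirements-dense = All.map (λ { {A , B} (∣A∣≤ , ∣B∣≤ , k≤) → separation-density (2 * b j) k A B ∣A∣≤ ∣B∣≤ k≤ })
                                 (All.all-filter (separable? j) (cartesianProduct (reduced σ) (reduced σ)))

    requirements-few : length Ps < 2 ^ (L + L)
    requirements-few = begin-strict
      length Ps                                   <⟨ List.filter-notAll (separable? j) pairs (Any.map (λ { refl → diagonal-inseparable }) diagonal∈) ⟩
      length pairs                                ≡⟨ length-cartesianProduct (reduced σ) (reduced σ) ⟩
      length (reduced σ) * length (reduced σ)     ≡⟨ cong (λ l → l * l) (List.length-map _ C) ⟩
      length C * length C                         ≤⟨ *-mono-≤ few-candidates few-candidates ⟩
      length E * length E                         ≤⟨ *-mono-≤ (n≤2^⌈log₂n⌉ (length E)) (n≤2^⌈log₂n⌉ (length E)) ⟩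
      2 ^ L * 2 ^ L                               ≡⟨ ^-distribˡ-+-* 2 L L ⟨
      2 ^ (L + L)                                 ∎
      where
      open ≤-Reasoning
      pairs = cartesianProduct (reduced σ) (reduced σ)
      diagonal∈ : (e* ─ A₀ , e* ─ A₀) ∈ pairs
      diagonal∈ = ∈-cartesianProduct⁺ (∈-map⁺ _ e*-candidate) (∈-map⁺ _ e*-candidate)
      diagonal-inseparable : ¬ Separable j (e* ─ A₀ , e* ─ A₀)
      diagonal-inseparable (_ , _ , k≤0) = <⇒≱ k-positive (subst (k ≤_) (∣p─p∣≡0 (e* ─ A₀)) k≤0)

    requirements-covered : ∀ {p} → p ∈ Ps → Any (λ T → separates-pair p T ≡ true) (separating σ)
    requirements-covered = greedy-covers k c (rounds j) (L + L) Ps (rounds-enough (b j) k k-positive (b-decreasing j j<s))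
                                         requirements-dense requirements-few

    survivors-close : ∀ {x y} → x ∈ C′ → y ∈ C′ → ∣ y ─ x ∣ < k
    survivors-close {x} {y} x∈C′ y∈C′ = ≰⇒> separated
      where
      separated : ¬ k ≤ ∣ y ─ x ∣
      separated k≤ = contradiction (begin
        false                   ≡⟨ x-missed ⟨
        response T (x ─ A₀)     ≡⟨ response-∩∁ T A₀ x ⟨
        response (T ∩ ∁ A₀) x   ≡⟨ proj₂ (survivor x∈C′) test∈ ⟩
        response (T ∩ ∁ A₀) e*  ≡⟨ proj₂ (survivor y∈C′) test∈ ⟨
        response (T ∩ ∁ A₀) y   ≡⟨ response-∩∁ T A₀ y ⟩
        response T (y ─ A₀)     ≡⟨ y-hit ⟩
        true                    ∎) λ ()
        where
        open ≡-Reasoning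
        x∈C = proj₁ (survivor x∈C′)
        y∈C = proj₁ (survivor y∈C′)
        separable : Separable j (x ─ A₀ , y ─ A₀)
        separable = candidate-anchor-close x∈C , candidate-anchor-close y∈C
                  , subst (k ≤_) (cong ∣_∣ (sym (agree⇒─-cancel A₀ x y (trans (survivor-agrees x∈C′) (sym (survivor-agrees y∈C′)))))) k≤
        pair∈ : (x ─ A₀ , y ─ A₀) ∈ Ps
        pair∈ = ∈-filter⁺ (separable? j) (∈-cartesianProduct⁺ (∈-map⁺ _ x∈C) (∈-map⁺ _ y∈C)) separable
        witness = find (requirements-covered pair∈)
        T = proj₁ witness
        test∈ : T ∩ ∁ A₀ ∈ Ts
        test∈ = ∈-++⁺ʳ (singletons (A₀ ─ R)) (∈-map⁺ (_∩ ∁ A₀) (proj₁ (proj₂ witness)))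
        x-missed = proj₁ (separates-true (x ─ A₀) (y ─ A₀) T (proj₂ (proj₂ witness)))
        y-hit    = proj₂ (separates-true (x ─ A₀) (y ─ A₀) T (proj₂ (proj₂ witness)))

    next-invariant : Invariant (advance σ)
    next-invariant = record
      { e*-candidate    = e*-survives
      ; few-candidates  = ≤-trans (List.length-filter _ C) few-candidates
      ; close           = λ e∈C′ → <⇒≤pred (survivors-close e*-survives e∈C′) , <⇒≤pred (survivors-close e∈C′ e*-survives)
      ; agree           = survivor-agrees
      ; reference-close = anchor-close j C R inv
      }

    stage-cost : length Ts ≤ 64 * budget j
    stage-cost = begin
      length Ts                                         ≡⟨ List.length-++ (singletons (A₀ ─ R)) ⟩
      length (singletons (A₀ ─ R)) + length (map (_∩ ∁ A₀) (separating σ))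
        ≡⟨ cong₂ _+_ (length-singletons (A₀ ─ R)) (trans (List.length-map _ (separating σ)) (length-greedy _ Ps)) ⟩
      ∣ A₀ ─ R ∣ + (L + L) * rounds j                   ≤⟨ +-monoˡ-≤ _ (new-tests-few j C R inv j<s) ⟩
      2 * previous j + (L + L) * rounds j               ≤⟨ +-monoˡ-≤ ((L + L) * rounds j) (*-monoˡ-≤ (previous j) {2} {64} (s≤s (s≤s z≤n))) ⟩
      64 * previous j + (L + L) * rounds j              ≡⟨ regroup (previous j) L (b j div k) ⟩
      64 * budget j                                     ∎
      where
      open ≤-Reasoning
      regroup : ∀ p L q → 64 * p + (L + L) * (32 * q) ≡ 64 * (q * L + p)
      regroup = solve-∀

  stages : History → List (Subset n)
  stages = stageTests ∘ stateAfter

  history : ℕ → History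
  history k = runFrom [] (Vec.replicate k stages) e*

  stateAfter-history-suc : ∀ k → stateAfter (history (suc k)) ≡ advance (stateAfter (history k))
  stateAfter-history-suc k = trans (cong stateAfter (runFrom-replicate-suc k [] stages e*)) (List.foldl-++ update _ (history k) _)

  next-invariant : ∀ σ → Invariant σ → stage σ < s → Invariant (advance σ)
  next-invariant σ inv j<s = Stage.next-invariant (stage σ) (candidates σ) (reference σ) inv j<s

  stage-cost : ∀ σ → Invariant σ → stage σ < s → length (stageTests σ) ≤ 64 * budget (stage σ)
  stage-cost σ inv j<s = Stage.stage-cost (stage σ) (candidates σ) (reference σ) inv j<s

  after-stages : ∀ k → k ≤ s → stage (stateAfter (history k)) ≡ k × Invariant (stateAfter (history k)) ×
                                testsFrom [] (Vec.replicate k stages) e* ≤ 64 * sumTo k budget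
  after-stages zero    _   = refl , initial-invariant , z≤n
  after-stages (suc k) k<s =
    trans (cong stage σ′≡) (cong suc stage≡k) ,
    subst Invariant (sym σ′≡) (next-invariant σ inv j<s) ,
    (begin
      testsFrom [] (Vec.replicate (suc k) stages) e*                   ≡⟨ testsFrom-replicate-suc k [] stages e* ⟩
      testsFrom [] (Vec.replicate k stages) e* + length (stageTests σ) ≤⟨ +-mono-≤ cost (stage-cost σ inv j<s) ⟩
      64 * sumTo k budget + 64 * budget (stage σ)                      ≡⟨ cong (λ j → 64 * sumTo k budget + 64 * budget j) stage≡k ⟩
      64 * sumTo k budget + 64 * budget k                              ≡⟨ *-distribˡ-+ 64 (sumTo k budget) (budget k) ⟨
      64 * sumTo (suc k) budget                                        ∎)
    where
    open ≤-Reasoning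
    σ = stateAfter (history k)
    σ′≡ = stateAfter-history-suc k
    ih = after-stages k (<⇒≤ k<s)
    stage≡k = proj₁ ih
    inv = proj₁ (proj₂ ih)
    cost = proj₂ (proj₂ ih)
    j<s = subst (_< s) (sym stage≡k) k<s

  radius-b≡1 : ∀ j → 1 ≤ j → b j ≡ 1 → radius j ≡ 0
  radius-b≡1 (suc j) _ bj≡1 = cong pred bj≡1

  sumTo-budget : ∀ t → 1 ≤ t → sumTo t budget ≡ bound d t L b
  sumTo-budget (suc t) _ = trans (sumTo-suc t budget) (cong (_+ sumTo t (budget ∘ suc)) (trans (+-identityʳ _) (cong (λ b₀ → (b₀ div b 1) * L) b0≡d)))

  decodes : 1 ≤ s → outcome (algorithm s) e* ≡ e*
  decodes 1≤s = ∣p─q∣≡0⇒∣q─p∣≡0⇒p≡q x e* (n≤0⇒n≡0 (subst (∣ x ─ e* ∣ ≤_) radius≡0 (proj₁ x-close)))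
                                          (n≤0⇒n≡0 (subst (∣ e* ─ x ∣ ≤_) radius≡0 (proj₂ x-close)))
    where
    final = after-stages s ≤-refl
    σ = stateAfter (history s)
    open Invariant (proj₁ (proj₂ final))
    x = representative (candidates σ)
    x-close = close (representative-∈ e*-candidate)
    radius≡0 : radius (stage σ) ≡ 0
    radius≡0 = trans (cong radius (proj₁ final)) (radius-b≡1 s 1≤s bs≡1)

  cost-bound : 1 ≤ s → numTests (algorithm s) e* ≤ 64 * bound d s L b
  cost-bound 1≤s = ≤-trans (proj₂ (proj₂ (after-stages s ≤-refl))) (≤-reflexive (cong (64 *_) (sumTo-budget s 1≤s)))

theorem4 : Σ ℕ λ C →
    (n d : ℕ) (E : List (Subset n)) → Unique E → All (λ e → ∣ e ∣ ≤ d) E →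
    (s : ℕ) → 1 ≤ s → s ≤ d →
    (b : ℕ → ℕ) → b 0 ≡ d → (∀ i → i < s → b (suc i) < b i) → b s ≡ 1 →
    Σ (Algorithm n s) λ A →
    (∀ e → e ∈ E →
    (outcome A e ≡ e) × (numTests A e ≤ C * bound d s ⌈log₂ length E ⌉ b))
theorem4 = 64 , λ n d E _ E-bounded s 1≤s _ b b0≡d b-decreasing bs≡1 →
  Staged.algorithm E b s , λ e* e*∈E →
    let open Correctness E-bounded b0≡d b-decreasing bs≡1 e*∈E in decodes 1≤s , cost-bound 1≤s
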